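{- Let $\varphi$ be a sentence as in the context. Then: (i) for all distinct indices $k,\ell\in\{0,\ldots,n\}$, $\widetilde{X}_k\cap\widetilde{X}_\ell=\emptyset$; (ii) for every $k$, $\mathrm{vars}(\widetilde{\mathcal{L}}_k)\cap\vec{y}\subseteq\bigcup_{1\le\ell\le k}\vec{y}_\ell$; (iii) if for all $k,\ell$ with $1\le\ell\le k\le n$ it holds $\mathrm{vars}(\mathcal{L}_k)\cap\vec{x}_\ell=\emptyset$, then for every $k$, $\widetilde{X}_k\subseteq\bigcup_{k<\ell\le n}\vec{x}_\ell$.
   Context: Let $\varphi := \forall \vec{x}_1 \exists \vec{y}_1 \ldots \forall \vec{x}_n \exists \vec{y}_n.\,\psi$ be a sentence in standard form ($\vec{x}_i,\vec{y}_i$ tuples of variables, $\vec{x}_1$, $\vec{y}_n$ possibly empty; $\psi$ quantifier-free, in negation normal form, using only $\wedge,\vee,\neg$; every prefix variable occurs in $\psi$; no variable bound twice) that may contain equality and constant symbols but no non-constant function symbols. Let $\vec{x}:=\bigcup_i\vec{x}_i$, $\vec{y}:=\bigcup_i\vec{y}_i$, and $\mathrm{vars}(S)$ the set of variables in a set $S$ of literals. Let $\mathcal{G}_\varphi$ be the undirected graph with vertex set $\vec{x}$ and an edge between $x,x'$ iff some atom of $\varphi$ contains both. For a connected component $C$ of $\mathcal{G}_\varphi$, $\mathcal{L}(C)$ is the set of literals of $\varphi$ containing at least one variable from $C$. For $1\le k\le n$, $\mathcal{L}_k$ is the smallest set of literals such that it contains all literals of $\varphi$ in which variables from $\vec{y}_k$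 occur, and for every connected component $C$ of $\mathcal{G}_\varphi$ containing a variable $x\in\mathrm{vars}(\mathcal{L}_k)$ we have $\mathcal{L}(C)\subseteq\mathcal{L}_k$. Set $\widetilde{\mathcal{L}}_k:=\mathcal{L}_k\setminus\bigcup_{\ell>k}\mathcal{L}_\ell$ for $1\le k\le n$, let $\widetilde{\mathcal{L}}_0$ be the set of literals of $\varphi$ belonging to none of $\widetilde{\mathcal{L}}_1,\ldots,\widetilde{\mathcal{L}}_n$, and $\widetilde{X}_k:=\mathrm{vars}(\widetilde{\mathcal{L}}_k)\cap\vec{x}$ for $0\le k\le n$. -}

module Defs where

open import Data.Nat using (ℕ; suc; _<_; _≤_)
open import Data.Fin using (Fin; zero; suc; toℕ)
open import Data.List using (List; []; _∷_; _++_; concatMap; allFin)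
open import Data.List.Membership.Propositional using (_∈_)
open import Data.List.Relation.Unary.Unique.Propositional using (Unique)
open import Data.Product using (Σ; ∃; _×_)
open import Data.Sum using (_⊎_)
open import Data.Empty using (⊥)
open import Relation.Nullary using (¬_)
open import Relation.Binary.PropositionalEquality using (_≡_; _≢_)
open import Relation.Binary.Construct.Closure.ReflexiveTransitive using (Star)

-- Syntax of the quantifier-free matrix ψ.
-- Variables, constant symbols and relation symbols are named by natural numbers.
-- No non-constant function symbols: a term is a variable or a constant.
data Term : Set where
  var   : ℕ → Term
  const : ℕ → Term

data Atom : Set where
  rel : ℕ → List Term → Atom
  eq  : Term → Term → Atom

data Literal : Set where
  pos : Atom → Literal
  neg : Atom → Literal

data QF : Set where
  lit  : Literal → QF
  _∧'_ : QF → QF → QF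
  _∨'_ : QF → QF → QF

termVars : Term → List ℕ
termVars (var v)   = v ∷ []
termVars (const _) = []

atomVars : Atom → List ℕ
atomVars (rel _ ts) = concatMap termVars ts
atomVars (eq s t)   = termVars s ++ termVars t

litVars : Literal → List ℕ
litVars (pos a) = atomVars a
litVars (neg a) = atomVars a

lits : QF → List Literal
lits (lit l)  = l ∷ []
lits (a ∧' b) = lits a ++ lits b
lits (a ∨' b) = lits a ++ lits b

qfVars : QF → List ℕ
qfVars ψ = concatMap litVars (lits ψ)

-- A sentence  ∀x₁∃y₁ … ∀xₙ∃yₙ. ψ  is given by n, the blocks xb, yb and ψ.
-- Block index i : Fin n stands for the paper's block number toℕ i + 1.
module Sentence (n : ℕ) (xb yb : Fin n → List ℕ) (ψ : QF) where

  prefixVars : List ℕ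
  prefixVars = concatMap (λ i → xb i ++ yb i) (allFin n)

  InX : ℕ → Set
  InX v = ∃ λ (i : Fin n) → v ∈ xb i

  InY : ℕ → Set
  InY v = ∃ λ (i : Fin n) → v ∈ yb i

  record StandardForm : Set where
    field
      closed      : ∀ v → v ∈ qfVars ψ → v ∈ prefixVars
      occurs      : ∀ v → v ∈ prefixVars → v ∈ qfVars ψ
      noDouble    : Unique prefixVars
      -- only x⃗₁ and y⃗ₙ may be empty
      xNonEmpty   : ∀ (i : Fin n) → 1 ≤ toℕ i → xb i ≢ []
      yNonEmpty   : ∀ (i : Fin n) → suc (toℕ i) < n → yb i ≢ []

  Edge : ℕ → ℕ → Set
  Edge x x' = InX x × InX x' × (∃ λ l → l ∈ lits ψ × x ∈ litVars l × x' ∈ litVars l)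

  SameComp : ℕ → ℕ → Set
  SameComp x z = InX x × Star Edge x z

  -- 𝓛_k (for block index k, paper's k = toℕ k + 1) as the least set
  -- containing the literals with variables of y⃗_k and closed under adding
  -- 𝓛(C) for every component C meeting vars(𝓛_k).
  data L (k : Fin n) : Literal → Set where
    base    : ∀ {l y} → l ∈ lits ψ → y ∈ yb k → y ∈ litVars l → L k l
    closure : ∀ {l' l x z} → L k l' → x ∈ litVars l' → SameComp x z →
              l ∈ lits ψ → z ∈ litVars l → L k l

  VarsL : Fin n → ℕ → Set
  VarsL k v = ∃ λ l → L k l × v ∈ litVars l

  -- 𝓛̃_k for k ∈ {0,…,n} (index k : Fin (suc n) is the paper's k itself)
  Lt : Fin (suc n) → Literal → Set
  Lt (suc k) l = L k l × (∀ (j : Fin n) → toℕ k < toℕ j → ¬ L j l)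
  Lt zero    l = l ∈ lits ψ × (∀ (j : Fin n) → ¬ Lt (suc j) l)

  VarsLt : Fin (suc n) → ℕ → Set
  VarsLt k v = ∃ λ l → Lt k l × v ∈ litVars l

  Xt : Fin (suc n) → ℕ → Set
  Xt k v = VarsLt k v × InX v

-- Membership of a literal in 𝓛̃_k depends only on which of the sets 𝓛_ℓ contain it:
-- 𝓛̃_k (k ≥ 1) consists of the literals whose largest such ℓ is k, and 𝓛̃_0 of those
-- lying in no 𝓛_ℓ.  Two literals sharing a variable of x⃗ lie in the same component
-- of 𝒢_φ, so the closure condition puts them into exactly the same sets 𝓛_ℓ; hence
-- they lie in the same 𝓛̃_k, which gives (i).  A literal containing a variable of y⃗_ℓ
-- lies in 𝓛_ℓ, so its index is at least ℓ, which gives (ii).  For (iii), a variable of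
-- X̃_k with k ≥ 1 lies in vars(𝓛_k), which the hypothesis keeps away from x⃗_ℓ for ℓ ≤ k.
module Submission where

open import Defs
open import Data.Nat using (ℕ; _<_; _≤_; suc; z≤n; s≤s; _≤?_)
open import Data.Nat.Properties using (≰⇒>; <-cmp)
open import Data.Fin as Fin using (Fin; toℕ; zero; suc)
open import Data.Fin.Induction using (>-wellFounded; Acc; acc)
open import Data.Fin.Properties using (toℕ-injective)
open import Data.List using (List)
open import Data.List.Membership.Propositional using (_∈_)
open import Data.Product using (∃; _×_; _,_; proj₁)
open import Data.Empty using (⊥; ⊥-elim)
open import Function using (_∘_)
open import Relation.Nullary using (¬_; yes; no; contradiction)
open import Relation.Binary using (tri<; tri≈; tri>)
open import Relation.Binary.PropositionalEquality using (_≡_; _≢_; refl; cong)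
open import Relation.Binary.Construct.Closure.ReflexiveTransitive using (ε)

module Layers (n : ℕ) (xb yb : Fin n → List ℕ) (ψ : QF) where
  open Sentence n xb yb ψ

  L⊆lits : ∀ {k l} → L k l → l ∈ lits ψ
  L⊆lits (base l∈ψ _ _)        = l∈ψ
  L⊆lits (closure _ _ _ l∈ψ _) = l∈ψ

  Lt⊆lits : ∀ k {l} → Lt k l → l ∈ lits ψ
  Lt⊆lits zero    (l∈ψ , _) = l∈ψ
  Lt⊆lits (suc k) (l∈L , _) = L⊆lits l∈L

  L-shareX : ∀ {k l l′ x} → InX x → x ∈ litVars l → x ∈ litVars l′ →
             l′ ∈ lits ψ → L k l → L k l′
  L-shareX x∈X x∈l x∈l′ l′∈ψ l∈L = closure l∈L x∈l (x∈X , ε) l′∈ψ x∈l′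

  Lt-respects-L : ∀ k {l l′} → (∀ j → L j l → L j l′) → (∀ j → L j l′ → L j l) →
                  l′ ∈ lits ψ → Lt k l → Lt k l′
  Lt-respects-L (suc k) to from _    (l∈L , top)  = to k l∈L , λ j k<j → top j k<j ∘ from j
  Lt-respects-L zero    to from l′∈ψ (l∈ψ , none) =
    l′∈ψ , λ j t → none j (Lt-respects-L (suc j) from to l∈ψ t)

  Lt-unique : ∀ k k′ {l} → Lt k l → Lt k′ l → k ≡ k′
  Lt-unique zero    zero    _            _            = refl
  Lt-unique zero    (suc j) (_ , none)   t            = ⊥-elim (none j t)
  Lt-unique (suc j) zero    t            (_ , none)   = ⊥-elim (none j t)
  Lt-unique (suc a) (suc b) (a∈ , a-top) (b∈ , b-top) with <-cmp (toℕ a) (toℕ b)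
  ... | tri< a<b _ _ = ⊥-elim (a-top b a<b b∈)
  ... | tri≈ _ a≡b _ = cong suc (toℕ-injective a≡b)
  ... | tri> _ _ b<a = ⊥-elim (b-top a b<a a∈)

  -- Descending from m through larger and larger indices must reach a top layer,
  -- because indices above m are bounded by n.
  L⇒¬Lt₀ : ∀ {m l} → L m l → ¬ Lt zero l
  L⇒¬Lt₀ {m} {l} l∈L (_ , none) = go m (>-wellFounded m) l∈L
    where
    go : ∀ j → Acc Fin._>_ j → L j l → ⊥
    go j (acc above) l∈Lj = none j (l∈Lj , λ i j<i → go i (above j<i))

  Xt-disjoint : ∀ k k′ → k ≢ k′ → ∀ v → Xt k v → Xt k′ v → ⊥
  Xt-disjoint k k′ k≢k′ v ((l , l∈k , v∈l) , v∈X) ((l′ , l′∈k′ , v∈l′) , _) =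
    k≢k′ (Lt-unique k k′ (Lt-respects-L k to from l′∈ψ l∈k) l′∈k′)
    where
    l∈ψ : l ∈ lits ψ
    l∈ψ = Lt⊆lits k l∈k
    l′∈ψ : l′ ∈ lits ψ
    l′∈ψ = Lt⊆lits k′ l′∈k′
    to : ∀ j → L j l → L j l′
    to j = L-shareX v∈X v∈l v∈l′ l′∈ψ
    from : ∀ j → L j l′ → L j l
    from j = L-shareX v∈X v∈l′ v∈l l∈ψ

  VarsLt∩Y⊆earlierY : ∀ k v → VarsLt k v → InY v →
                      ∃ λ (j : Fin n) → suc (toℕ j) ≤ toℕ k × v ∈ yb j
  VarsLt∩Y⊆earlierY zero v (l , l∈0 , v∈l) (j , v∈yj) =
    ⊥-elim (L⇒¬Lt₀ (base (proj₁ l∈0) v∈yj v∈l) l∈0)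
  VarsLt∩Y⊆earlierY (suc k) v (l , (l∈L , top) , v∈l) (j , v∈yj) with toℕ j ≤? toℕ k
  ... | yes j≤k = j , s≤s j≤k , v∈yj
  ... | no  j≰k = contradiction (base (L⊆lits l∈L) v∈yj v∈l) (top j (≰⇒> j≰k))

  Xt⊆laterX : (∀ (k l : Fin n) → toℕ l ≤ toℕ k → ∀ v → VarsL k v → v ∈ xb l → ⊥) →
              ∀ k v → Xt k v → ∃ λ (j : Fin n) → toℕ k < suc (toℕ j) × v ∈ xb j
  Xt⊆laterX _        zero    v (_ , j , v∈xj) = j , s≤s z≤n , v∈xj
  Xt⊆laterX disjoint (suc k) v ((l , (l∈L , _) , v∈l) , j , v∈xj) with toℕ j ≤? toℕ k
  ... | yes j≤k = ⊥-elim (disjoint k j j≤k v (l , l∈L , v∈l) v∈xj)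
  ... | no  j≰k = j , s≤s (≰⇒> j≰k) , v∈xj

lemma3 : (n : ℕ) (xb yb : Fin n → List ℕ) (ψ : QF) →
         Sentence.StandardForm n xb yb ψ →
         ((∀ (k l : Fin (suc n)) → k ≢ l → ∀ (v : ℕ) →
            Sentence.Xt n xb yb ψ k v → Sentence.Xt n xb yb ψ l v → ⊥)
         × (∀ (k : Fin (suc n)) (v : ℕ) →
            Sentence.VarsLt n xb yb ψ k v → Sentence.InY n xb yb ψ v →
            ∃ λ (j : Fin n) → suc (toℕ j) ≤ toℕ k × v ∈ yb j)
         × ((∀ (k l : Fin n) → toℕ l ≤ toℕ k → ∀ (v : ℕ) →
              Sentence.VarsL n xb yb ψ k v → v ∈ xb l → ⊥) →
            ∀ (k : Fin (suc n)) (v : ℕ) → Sentence.Xt n xb yb ψ k v →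
            ∃ λ (j : Fin n) → toℕ k < suc (toℕ j) × v ∈ xb j))
lemma3 n xb yb ψ _ = Xt-disjoint , VarsLt∩Y⊆earlierY , Xt⊆laterX
  where open Layers n xb yb ψ
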